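{- Let $A$ be an antisymmetric s-acyclic relation on $2^\omega$. Then the relation $G_A:=\{(0\alpha,1\beta)\mid(\alpha,\beta)\in A\}$ on $2^\omega$ is s-acyclic.
   Context: $A^{ -1}:=\{(x,y)\mid(y,x)\in A\}$, $s(A):=A\cup A^{ -1}$. $A$ is antisymmetric if $A\cap A^{ -1}$ is contained in the diagonal. A relation $R$ is acyclic if there is no injective sequence $(x_i)_{i\leq n}$ with $n\geq2$, $(x_i,x_{i+1})\in R$ for $i<n$ and $(x_n,x_0)\in R$; $R$ is s-acyclic if $s(R)$ is acyclic. $0\alpha$ denotes the sequence $\alpha$ with $0$ prepended. -}

module Defs where

open import Data.Nat using (ℕ; zero; suc; _≤_)
open import Data.Bool using (Bool; true; false)
open import Data.Fin using (Fin; zero; suc; inject₁; fromℕ)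
open import Data.Product using (Σ; ∃; _×_; _,_)
open import Data.Sum using (_⊎_)
open import Relation.Nullary using (¬_)
open import Relation.Binary.PropositionalEquality using (_≡_; _≗_)

-- Cantor space 2^ω : infinite binary sequences.  Two points are equal iff
-- they agree pointwise (_≗_), as for sets of functions.
Cantor : Set
Cantor = ℕ → Bool

BinRel : Set₁
BinRel = Cantor → Cantor → Set

-- A relation on 2^ω (a set of pairs) must respect equality of points.
RespectsEq : BinRel → Set
RespectsEq R = ∀ {x x′ y y′} → x ≗ x′ → y ≗ y′ → R x y → R x′ y′

_⁻¹ : BinRel → BinRel
(R ⁻¹) x y = R y x

s : BinRel → BinRel
s R x y = R x y ⊎ (R ⁻¹) x y

Antisymmetric : BinRel → Set
Antisymmetric R = ∀ x y → R x y → (R ⁻¹) x y → x ≗ y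

IsCycle : BinRel → (n : ℕ) → (Fin (suc n) → Cantor) → Set
IsCycle R n x =
  (∀ i j → x i ≗ x j → i ≡ j)
  × (∀ (i : Fin n) → R (x (inject₁ i)) (x (suc i)))
  × R (x (fromℕ n)) (x zero)

Acyclic : BinRel → Set
Acyclic R = ∀ n → 2 ≤ n → (x : Fin (suc n) → Cantor) → ¬ IsCycle R n x

SAcyclic : BinRel → Set
SAcyclic R = Acyclic (s R)

_∷ᶜ_ : Bool → Cantor → Cantor
(b ∷ᶜ α) zero = b
(b ∷ᶜ α) (suc n) = α n

G : BinRel → BinRel
G A x y = Σ Cantor λ α → Σ Cantor λ β →
  (x ≗ (false ∷ᶜ α)) × (y ≗ (true ∷ᶜ β)) × A α β

-- Every edge of s(G_A) joins a point with head 0 to a point with head 1, so along a cycle in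
-- s(G_A) the heads alternate and the tails form a closed walk in s(A) that crosses an edge
-- (α, β) of A forwards when leaving head 0 and backwards when leaving head 1.  Injectivity of the
-- cycle forbids this walk to backtrack (points two steps apart share their head), and
-- antisymmetry of A forbids it to backtrack across a repeated point.  Skipping the repeated
-- points yields a closed walk in s(A) without loops or backtracks, and its first return to an
-- earlier point closes a cycle in s(A).  Deciding which points repeat is classical, which is
-- harmless since the goal is a negation.
module Submission where

open import Defs
open import Data.Nat
open import Data.Nat.Properties
open import Data.Nat.Induction using (<-rec)
open import Data.Nat.DivMod using (_mod_; m<n⇒m%n≡m; n%n≡0)
open import Data.Bool using (Bool; true; false; not)
open import Data.Bool.Properties using (not-involutive)
open import Data.Fin using (Fin; zero; suc; toℕ; fromℕ; fromℕ<; inject₁)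
open import Data.Fin.Properties using (toℕ-injective; toℕ-inject₁; toℕ-fromℕ; toℕ-fromℕ<; toℕ<n)
open import Data.Product using (∃; _×_; _,_; proj₁; proj₂)
open import Data.Sum using (inj₁; inj₂)
open import Data.Empty using (⊥)
open import Function using (_∘_)
open import Relation.Nullary using (¬_; Dec; yes; no; contradiction)
open import Relation.Nullary.Decidable using (¬¬-excluded-middle)
open import Relation.Binary using (Setoid)
open import Relation.Binary.Definitions using (tri<; tri≈; tri>)
open import Relation.Binary.PropositionalEquality

open Setoid (ℕ →-setoid Bool) using () renaming (sym to ≗-sym; trans to ≗-trans)

s-respects : {R : BinRel} → RespectsEq R → RespectsEq (s R)
s-respects resp e e′ (inj₁ r) = inj₁ (resp e e′ r)
s-respects resp e e′ (inj₂ r) = inj₂ (resp e′ e r)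

Walk : BinRel → (ℕ → Cantor) → ℕ → Set
Walk R w K = ∀ k → k < K → R (w k) (w (suc k))

Loopless : (ℕ → Cantor) → ℕ → Set
Loopless w K = ∀ k → k < K → ¬ w k ≗ w (suc k)

NonBacktracking : (ℕ → Cantor) → ℕ → Set
NonBacktracking w K = ∀ k → 2 + k ≤ K → ¬ w k ≗ w (2 + k)

walk-isCycle : {R : BinRel} (u : ℕ → Cantor) (m : ℕ) → Walk R u m → R (u m) (u 0) →
  (∀ t t′ → t < t′ → t′ ≤ m → ¬ u t ≗ u t′) → IsCycle R m (u ∘ toℕ)
walk-isCycle {R} u m walk closing distinct = injective , edges , closing′
  where
  injective : ∀ i j → u (toℕ i) ≗ u (toℕ j) → i ≡ j
  injective i j e with <-cmp (toℕ i) (toℕ j)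
  ... | tri< i<j _ _ = contradiction e (distinct _ _ i<j (s≤s⁻¹ (toℕ<n j)))
  ... | tri≈ _ i≡j _ = toℕ-injective i≡j
  ... | tri> _ _ j<i = contradiction (≗-sym e) (distinct _ _ j<i (s≤s⁻¹ (toℕ<n i)))

  edges : ∀ (i : Fin m) → R (u (toℕ (inject₁ i))) (u (suc (toℕ i)))
  edges i = subst (λ t → R (u t) (u (suc (toℕ i)))) (sym (toℕ-inject₁ i))
    (walk (toℕ i) (toℕ<n i))

  closing′ : R (u (toℕ (fromℕ m))) (u 0)
  closing′ = subst (λ t → R (u t) (u 0)) (sym (toℕ-fromℕ m)) closing

data Gap (i : ℕ) : ℕ → Set where
  gap-1 : Gap i (1 + i)
  gap-2 : Gap i (2 + i)
  gap-3+ : ∀ m → 2 ≤ m → Gap i (suc (i + m))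

gap : ∀ {i j} → i < j → Gap i j
gap {zero} {suc zero} _ = gap-1
gap {zero} {suc (suc zero)} _ = gap-2
gap {zero} {suc (suc (suc j))} _ = gap-3+ (suc (suc j)) (s≤s (s≤s z≤n))
gap {suc i} {suc j} (s≤s i<j) with gap i<j
... | gap-1 = gap-1
... | gap-2 = gap-2
... | gap-3+ m 2≤m = gap-3+ m 2≤m

module _ {R : BinRel} (resp : RespectsEq R) (acyclic : Acyclic R)
  {w : ℕ → Cantor} {K : ℕ} (walk : Walk R w K) (loopless : Loopless w K)
  (nonbacktracking : NonBacktracking w K) where

  -- The first return of the walk to an earlier point closes a cycle of length at least 3.
  acyclic-walk-injective : ∀ j → j ≤ K → ∀ i → i < j → ¬ w i ≗ w j
  acyclic-walk-injective = <-rec _ λ j rec j≤K i i<j → go rec j≤K (gap i<j)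
    where
    go : ∀ {i j} → (∀ {j′} → j′ < j → j′ ≤ K → ∀ i′ → i′ < j′ → ¬ w i′ ≗ w j′) → j ≤ K →
      Gap i j → ¬ w i ≗ w j
    go {i} _ j≤K gap-1 = loopless i j≤K
    go {i} _ j≤K gap-2 = nonbacktracking i j≤K
    go {i} rec j≤K (gap-3+ m 2≤m) e =
      acyclic m 2≤m (u ∘ toℕ) (walk-isCycle {R} u m segment closing distinct)
      where
      u : ℕ → Cantor
      u t = w (i + t)

      in-segment : ∀ {t} → t ≤ m → i + t < suc (i + m)
      in-segment t≤m = s≤s (+-monoʳ-≤ i t≤m)

      segment : Walk R u m
      segment t t<m = subst (λ k → R (u t) (w k)) (sym (+-suc i t))
        (walk (i + t) (≤-trans (+-monoʳ-< i t<m) (≤-trans (n≤1+n _) j≤K)))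

      closing : R (u m) (u 0)
      closing = resp (λ _ → refl) back-to-start (walk (i + m) j≤K)
        where
        back-to-start : w (suc (i + m)) ≗ u 0
        back-to-start = ≗-trans (≗-sym e) (λ k → cong (λ t → w t k) (sym (+-identityʳ i)))

      distinct : ∀ t t′ → t < t′ → t′ ≤ m → ¬ u t ≗ u t′
      distinct t t′ t<t′ t′≤m = rec (in-segment t′≤m)
        (≤-trans (<⇒≤ (in-segment t′≤m)) j≤K) (i + t) (+-monoʳ-< i t<t′)

¬¬-decidable-below : (Q : ℕ → Set) (N : ℕ) → ¬ ¬ (∀ t → t < N → Dec (Q t))
¬¬-decidable-below Q zero k = k (λ _ ())
¬¬-decidable-below Q (suc N) k =
  ¬¬-decidable-below Q N λ dec → ¬¬-excluded-middle λ Q? → k (extend dec Q?)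
  where
  extend : (∀ t → t < N → Dec (Q t)) → Dec (Q N) → ∀ t → t < suc N → Dec (Q t)
  extend dec Q? t t<1+N with m≤n⇒m<n∨m≡n (s≤s⁻¹ t<1+N)
  ... | inj₁ t<N = dec t t<N
  ... | inj₂ refl = Q?

increasing⇒monotone : {f : ℕ → ℕ} → (∀ k → f k < f (suc k)) → ∀ {k k′} → k ≤′ k′ → f k ≤ f k′
increasing⇒monotone inc ≤′-refl = ≤-refl
increasing⇒monotone inc (≤′-step k≤′k′) = ≤-trans (increasing⇒monotone inc k≤′k′) (<⇒≤ (inc _))

increasing-bracket : {f : ℕ → ℕ} → (∀ k → f k < f (suc k)) → f 0 ≡ 0 →
  ∀ N → ∃ λ K → f K ≤ N × N < f (suc K)
increasing-bracket {f} inc f0≡0 zero = 0 , ≤-reflexive f0≡0 , subst (_< f 1) f0≡0 (inc 0)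
increasing-bracket {f} inc f0≡0 (suc N) with increasing-bracket inc f0≡0 N
... | K , fK≤N , N<fK+1 with suc N <? f (suc K)
...   | yes 1+N<fK+1 = K , m≤n⇒m≤1+n fK≤N , 1+N<fK+1
...   | no 1+N≮fK+1 = suc K , ≮⇒≥ 1+N≮fK+1 , ≤-<-trans N<fK+1 (inc (suc K))

NoStutterBacktrack : (ℕ → Cantor) → ℕ → Set
NoStutterBacktrack v N =
  ∀ t → 3 + t ≤ N → ¬ v t ≗ v (1 + t) → v (1 + t) ≗ v (2 + t) → ¬ v t ≗ v (3 + t)

module Shortcut {R : BinRel} (resp : RespectsEq R) {v : ℕ → Cantor} {N : ℕ}
  (walk : Walk R v N) (nonbacktracking : NonBacktracking v N)
  (no-stutter-backtrack : NoStutterBacktrack v N)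
  (stutter? : ∀ t → t < N → Dec (v t ≗ v (suc t))) where

  data Hop (p : ℕ) : ℕ → Set where
    step : ¬ v p ≗ v (1 + p) → Hop p (1 + p)
    skip : v p ≗ v (1 + p) → Hop p (2 + p)

  jump : ℕ → ℕ
  jump p with p <? N
  ... | no _ = 1 + p
  ... | yes p<N with stutter? p p<N
  ...   | yes _ = 2 + p
  ...   | no _ = 1 + p

  hop-jump : ∀ p → p < N → Hop p (jump p)
  hop-jump p p<N with p <? N
  ... | no p≮N = contradiction p<N p≮N
  ... | yes p<N′ with stutter? p p<N′
  ...   | yes e = skip e
  ...   | no ¬e = step ¬e

  <-jump : ∀ p → p < jump p
  <-jump p with p <? N
  ... | no _ = n<1+n p
  ... | yes p<N with stutter? p p<N
  ...   | yes _ = m<n+m p (s≤s z≤n)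
  ...   | no _ = n<1+n p

  hop-≤ : ∀ {p q} → Hop p q → q ≤ 2 + p
  hop-≤ (step _) = n≤1+n _
  hop-≤ (skip _) = ≤-refl

  hop-walk : ∀ {p q} → Hop p q → q ≤ N → R (v p) (v q) × ¬ v p ≗ v q
  hop-walk (step ¬e) q≤N = walk _ q≤N , ¬e
  hop-walk {p} (skip e) q≤N =
    resp (≗-sym e) (λ _ → refl) (walk (1 + p) q≤N) , nonbacktracking p q≤N

  hop-hop-nonbacktracking : ∀ {p q r} → Hop p q → Hop q r → r ≤ N → ¬ v p ≗ v r
  hop-hop-nonbacktracking {p} (step _) (step _) r≤N = nonbacktracking p r≤N
  hop-hop-nonbacktracking {p} (step ¬e) (skip e′) r≤N = no-stutter-backtrack p r≤N ¬e e′
  hop-hop-nonbacktracking {p} (skip e) (step _) r≤N e″ =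
    nonbacktracking (1 + p) r≤N (≗-trans (≗-sym e) e″)
  hop-hop-nonbacktracking {p} (skip e) (skip e′) r≤N e″ =
    no-stutter-backtrack (1 + p) r≤N ¬e₁ e′ (≗-trans (≗-sym e) e″)
    where
    ¬e₁ : ¬ v (1 + p) ≗ v (2 + p)
    ¬e₁ e₁ = nonbacktracking p (≤-trans (m≤n+m (2 + p) 2) r≤N) (≗-trans e e₁)

  hop-overshoot : ∀ {p q} → Hop p q → p < N → N < q → v p ≗ v N
  hop-overshoot (step _) p<N N<q = contradiction (s≤s⁻¹ N<q) (<⇒≱ p<N)
  hop-overshoot {p} (skip e) p<N N<q = subst (λ k → v p ≗ v k) (≤-antisym p<N (s≤s⁻¹ N<q)) e

  point : ℕ → ℕ
  point zero = 0
  point (suc k) = jump (point k)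

  hop-point : ∀ k → point (suc k) ≤ N → Hop (point k) (point (suc k))
  hop-point k le = hop-jump (point k) (<-≤-trans (<-jump (point k)) le)

  -- The points visited by the hops form a loopless, non-backtracking walk returning to v 0.
  closed-walk-⊥ : Acyclic R → 2 ≤ N → v N ≗ v 0 → ⊥
  closed-walk-⊥ acyclic 2≤N closed with increasing-bracket (<-jump ∘ point) refl N
  ... | K , pK≤N , N<pK+1 =
    acyclic-walk-injective resp acyclic walk′ loopless′ nonbacktracking′
      K ≤-refl 0 (positive K N<pK+1) (≗-sym returns)
    where
    below : ∀ k → k ≤ K → point k ≤ N
    below k k≤K = ≤-trans (increasing⇒monotone (<-jump ∘ point) (≤⇒≤′ k≤K)) pK≤N

    hop-below : ∀ k → 1 + k ≤ K → Hop (point k) (point (1 + k))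
    hop-below k 1+k≤K = hop-point k (below (1 + k) 1+k≤K)

    w : ℕ → Cantor
    w = v ∘ point

    walk′ : Walk R w K
    walk′ k k<K = proj₁ (hop-walk (hop-below k k<K) (below (1 + k) k<K))

    loopless′ : Loopless w K
    loopless′ k k<K = proj₂ (hop-walk (hop-below k k<K) (below (1 + k) k<K))

    nonbacktracking′ : NonBacktracking w K
    nonbacktracking′ k 2+k≤K = hop-hop-nonbacktracking
      (hop-below k (≤-trans (n≤1+n _) 2+k≤K)) (hop-below (1 + k) 2+k≤K) (below (2 + k) 2+k≤K)

    positive : ∀ k → N < point (suc k) → 0 < k
    positive zero N<jump0 =
      contradiction 2≤N (<⇒≱ (<-≤-trans N<jump0 (hop-≤ (hop-jump 0 (≤-trans (s≤s z≤n) 2≤N)))))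
    positive (suc _) _ = s≤s z≤n

    returns : w K ≗ v 0
    returns with m≤n⇒m<n∨m≡n pK≤N
    ... | inj₁ pK<N = ≗-trans (hop-overshoot (hop-jump _ pK<N) pK<N N<pK+1) closed
    ... | inj₂ pK≡N = subst (λ k → v k ≗ v 0) (sym pK≡N) closed

acyclic-closed-walk-⊥ : {R : BinRel} → RespectsEq R → Acyclic R → {v : ℕ → Cantor} {N : ℕ} →
  2 ≤ N → Walk R v N → v N ≗ v 0 → NonBacktracking v N → NoStutterBacktrack v N → ⊥
acyclic-closed-walk-⊥ resp acyclic {v} {N} 2≤N walk closed nonbacktracking no-stutter-backtrack =
  ¬¬-decidable-below (λ t → v t ≗ v (suc t)) N λ stutter? →
    Shortcut.closed-walk-⊥ resp walk nonbacktracking no-stutter-backtrack stutter?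
      acyclic 2≤N closed

unroll : {n : ℕ} → (Fin (suc n) → Cantor) → ℕ → Cantor
unroll {n} x t = x (t mod suc n)

toℕ-mod : ∀ {n t} → t < suc n → toℕ (t mod suc n) ≡ t
toℕ-mod t<1+n = trans (toℕ-fromℕ< _) (m<n⇒m%n≡m t<1+n)

mod-≡ : ∀ {n t} {i : Fin (suc n)} → t < suc n → toℕ i ≡ t → t mod suc n ≡ i
mod-≡ t<1+n i≡t = toℕ-injective (trans (toℕ-mod t<1+n) (sym i≡t))

mod-self : ∀ n → suc n mod suc n ≡ zero
mod-self n = toℕ-injective (trans (toℕ-fromℕ< _) (n%n≡0 (suc n)))

module Unroll {R : BinRel} {n : ℕ} {x : Fin (suc n) → Cantor} (cycle : IsCycle R n x) where

  unroll-walk : Walk R (unroll x) (suc n)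
  unroll-walk t t<1+n with m≤n⇒m<n∨m≡n (s≤s⁻¹ t<1+n)
  ... | inj₁ t<n = subst₂ (λ i j → R (x i) (x j))
    (sym (mod-≡ t<1+n (trans (toℕ-inject₁ _) (toℕ-fromℕ< t<n))))
    (sym (mod-≡ (s≤s t<n) (cong suc (toℕ-fromℕ< t<n))))
    (proj₁ (proj₂ cycle) (fromℕ< t<n))
  ... | inj₂ refl = subst₂ (λ i j → R (x i) (x j))
    (sym (mod-≡ t<1+n (toℕ-fromℕ n))) (sym (mod-self n)) (proj₂ (proj₂ cycle))

  unroll-closed : unroll x (suc n) ≡ unroll x 0
  unroll-closed = cong x (mod-self n)

  unroll-injective : ∀ {t t′} → t < t′ → t′ ≤ suc n → unroll x t ≗ unroll x t′ →
    t ≡ 0 × t′ ≡ suc n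
  unroll-injective {t} {t′} t<t′ t′≤1+n e with m≤n⇒m<n∨m≡n t′≤1+n
  ... | inj₁ t′<1+n = contradiction t≡t′ (<⇒≢ t<t′)
    where
    t≡t′ : t ≡ t′
    t≡t′ = trans (sym (toℕ-mod (<-trans t<t′ t′<1+n)))
      (trans (cong toℕ (proj₁ cycle _ _ e)) (toℕ-mod t′<1+n))
  ... | inj₂ refl =
    trans (sym (toℕ-mod t<t′)) (cong toℕ (trans (proj₁ cycle _ _ e) (mod-self n))) , refl

tail : Cantor → Cantor
tail α k = α (suc k)

head-tail-≗ : {α β : Cantor} → α 0 ≡ β 0 → tail α ≗ tail β → α ≗ β
head-tail-≗ h t zero = h
head-tail-≗ h t (suc k) = t k

orient : Bool → BinRel → BinRel
orient false A = A
orient true A = A ⁻¹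

orient⊆s : ∀ b {A α β} → orient b A α β → s A α β
orient⊆s false = inj₁
orient⊆s true = inj₂

orient-respects : ∀ b {A} → RespectsEq A → RespectsEq (orient b A)
orient-respects false resp e e′ = resp e e′
orient-respects true resp e e′ = resp e′ e

orient-antisym : ∀ b {A} → Antisymmetric A → ∀ {α β} → orient b A α β → orient b A β α → α ≗ β
orient-antisym false anti r r′ = anti _ _ r r′
orient-antisym true anti r r′ = anti _ _ r′ r

sG-edge : ∀ {A} → RespectsEq A → ∀ {α β} → s (G A) α β →
  β 0 ≡ not (α 0) × orient (α 0) A (tail α) (tail β)
sG-edge resp (inj₁ (α′ , β′ , α≗ , β≗ , a)) rewrite α≗ 0 | β≗ 0 =
  refl , resp (≗-sym (α≗ ∘ suc)) (≗-sym (β≗ ∘ suc)) a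
sG-edge resp (inj₂ (β′ , α′ , β≗ , α≗ , a)) rewrite α≗ 0 | β≗ 0 =
  refl , resp (≗-sym (β≗ ∘ suc)) (≗-sym (α≗ ∘ suc)) a

module TailWalk {A : BinRel} (resp : RespectsEq A) (anti : Antisymmetric A)
  {n : ℕ} (2≤n : 2 ≤ n) {x : Fin (suc n) → Cantor} (cycle : IsCycle (s (G A)) n x) where

  open Unroll {R = s (G A)} cycle

  bit : ℕ → Bool
  bit t = unroll x t 0

  v : ℕ → Cantor
  v t = tail (unroll x t)

  edge : ∀ t → t < suc n → bit (1 + t) ≡ not (bit t) × orient (bit t) A (v t) (v (1 + t))
  edge t t<1+n = sG-edge resp (unroll-walk t t<1+n)

  bit-period : ∀ t → 2 + t ≤ suc n → bit (2 + t) ≡ bit t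
  bit-period t 2+t≤1+n = begin
    bit (2 + t)        ≡⟨ proj₁ (edge (1 + t) 2+t≤1+n) ⟩
    not (bit (1 + t))  ≡⟨ cong not (proj₁ (edge t (≤-trans (n≤1+n _) 2+t≤1+n))) ⟩
    not (not (bit t))  ≡⟨ not-involutive (bit t) ⟩
    bit t              ∎
    where open ≡-Reasoning

  tail-walk : Walk (s A) v (suc n)
  tail-walk t t<1+n = orient⊆s (bit t) (proj₂ (edge t t<1+n))

  tail-closed : v (suc n) ≗ v 0
  tail-closed k = cong (λ α → α (suc k)) unroll-closed

  tail-nonbacktracking : NonBacktracking v (suc n)
  tail-nonbacktracking t 2+t≤1+n e
    with unroll-injective (m<n+m t (s≤s z≤n)) 2+t≤1+n
           (head-tail-≗ (sym (bit-period t 2+t≤1+n)) e)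
  ... | refl , 2≡1+n = <-irrefl (suc-injective 2≡1+n) 2≤n

  -- Edges t and 2 + t carry the same orientation, so crossing the same pair of points in
  -- opposite directions contradicts antisymmetry.
  tail-no-stutter-backtrack : NoStutterBacktrack v (suc n)
  tail-no-stutter-backtrack t 3+t≤1+n ¬e₀₁ e₁₂ e₀₃ =
    ¬e₀₁ (orient-antisym (bit t) {A} anti forwards backwards)
    where
    forwards : orient (bit t) A (v t) (v (1 + t))
    forwards = proj₂ (edge t (≤-trans (m≤n+m (1 + t) 2) 3+t≤1+n))

    backwards : orient (bit t) A (v (1 + t)) (v t)
    backwards = orient-respects (bit t) {A} resp (≗-sym e₁₂) (≗-sym e₀₃)
      (subst (λ b → orient b A (v (2 + t)) (v (3 + t)))
        (bit-period t (≤-trans (n≤1+n _) 3+t≤1+n)) (proj₂ (edge (2 + t) 3+t≤1+n)))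

lemma3p8 : (A : BinRel) → RespectsEq A → Antisymmetric A → SAcyclic A → SAcyclic (G A)
lemma3p8 A resp anti acyclic n 2≤n x cycle =
  acyclic-closed-walk-⊥ (s-respects resp) acyclic (m≤n⇒m≤1+n 2≤n)
    tail-walk tail-closed tail-nonbacktracking tail-no-stutter-backtrack
  where open TailWalk resp anti 2≤n cycle
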